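{- Let $H$ be a digraph (possibly with loops), $D$ an $H$-colored digraph and $\mathscr{F}$ an $H$-class partition of $A(D)$. If $\mathcal{S}$ is a nonempty subset of $\mathscr{F}$ and $K$ is a kernel by paths in $D\langle\bigcup_{F\in\mathcal{S}}F\rangle$, then for every $x\in K$, $N^-_{\mathscr{F}}(x)\cap\mathcal{S}\neq\emptyset$.
   Context: An $H$-colored digraph is a finite digraph $D$ without loops with a coloring $\rho:A(D)\to V(H)$. For $F\subseteq A(D)$, $D\langle F\rangle$ is the digraph with arc set $F$ and vertex set the vertices incident with an arc of $F$. An $H$-class partition of $A(D)$ is a partition $\mathscr{F}$ of $A(D)$ such that for all arcs $(u,v),(v,w)$ of $D$, $(\rho(u,v),\rho(v,w))\in A(H)$ iff some $F\in\mathscr{F}$ contains both arcs. $N^-_{\mathscr{F}}(x)=\{F\in\mathscr{F}:(u,x)\in F\text{ for some }u\in V(D)\}$. A kernel by paths in a digraph is a vertex set $K$ with no path between two different vertices of $K$ and such that every vertex not in $K$ has a path to some vertex of $K$. -}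

module Defs where

open import Data.Nat using (ℕ)
open import Data.Fin using (Fin)
open import Data.Fin.Subset using (Subset; _∈_; Nonempty)
open import Data.Bool using (Bool; true; false)
open import Data.List using (List; []; _∷_)
open import Data.List.Relation.Unary.Unique.Propositional using (Unique)
open import Data.Product using (Σ; ∃; _×_; _,_)
open import Data.Sum using (_⊎_)
open import Relation.Binary.PropositionalEquality using (_≡_; _≢_)
open import Relation.Nullary using (¬_)
open import Function.Bundles using (_⇔_)

record Digraph (n : ℕ) : Set where
  field
    adj : Fin n → Fin n → Bool

  Arc : Fin n → Fin n → Set
  Arc u v = adj u v ≡ true

Loopless : ∀ {n} → Digraph n → Set
Loopless D = ∀ u → Digraph.adj D u u ≡ false

-- An H-colored digraph: D loopless, coloring ρ : A(D) → V(H).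
-- ρ is given on all ordered pairs, only its values on arcs matter.
record HColoredDigraph {m : ℕ} (H : Digraph m) (n : ℕ) : Set where
  field
    D        : Digraph n
    loopless : Loopless D
    ρ        : Fin n → Fin n → Fin m
  open Digraph D public

-- An H-class partition of A(D), with classes indexed by Fin k:
-- cls u v is the class containing the arc (u,v) (only meaningful on arcs);
-- every class is nonempty (so it is a genuine partition of A(D));
-- and for arcs (u,v),(v,w): (ρ(u,v),ρ(v,w)) ∈ A(H) iff they lie in a common class.
record HClassPartition {m n : ℕ} {H : Digraph m} (D : HColoredDigraph H n) (k : ℕ) : Set where
  open HColoredDigraph D
  field
    cls      : Fin n → Fin n → Fin k
    nonempty : ∀ (i : Fin k) → ∃ λ u → ∃ λ v → Arc u v × cls u v ≡ i
    hclass   : ∀ u v w → Arc u v → Arc v w →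
               (Digraph.Arc H (ρ u v) (ρ v w) ⇔ (cls u v ≡ cls v w))

module _ {m n k : ℕ} {H : Digraph m} {D : HColoredDigraph H n}
         (𝓕 : HClassPartition D k) where
  open HColoredDigraph D
  open HClassPartition 𝓕

  SubArc : Subset k → Fin n → Fin n → Set
  SubArc S u v = Arc u v × cls u v ∈ S

  -- vertices of D⟨⋃_{F ∈ S} F⟩: vertices incident with such an arc
  SubVertex : Subset k → Fin n → Set
  SubVertex S x = ∃ λ y → SubArc S x y ⊎ SubArc S y x

  InNbhdMeetsS : Subset k → Fin n → Set
  InNbhdMeetsS S x = ∃ λ F → F ∈ S × (∃ λ u → Arc u x × cls u x ≡ F)

data Walk {n : ℕ} (R : Fin n → Fin n → Set) : Fin n → Fin n → Set where
  stop : ∀ u → Walk R u u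
  step : ∀ {u v w} → R u v → Walk R v w → Walk R u w

walkVertices : ∀ {n} {R : Fin n → Fin n → Set} {u v} → Walk R u v → List (Fin n)
walkVertices (stop u) = u ∷ []
walkVertices (step {u} _ w) = u ∷ walkVertices w

Path : ∀ {n} → (Fin n → Fin n → Set) → Fin n → Fin n → Set
Path R u v = Σ (Walk R u v) λ w → Unique (walkVertices w)

record KernelByPaths {n : ℕ} (V : Fin n → Set) (R : Fin n → Fin n → Set)
                     (K : Subset n) : Set where
  field
    inV         : ∀ x → x ∈ K → V x
    independent : ∀ x y → x ∈ K → y ∈ K → x ≢ y → ¬ Path R x y
    absorbing   : ∀ x → V x → ¬ (x ∈ K) → ∃ λ y → y ∈ K × Path R x y

{-# OPTIONS --safe #-}
module Submission where

-- x ∈ K lies on some arc of D⟨⋃S⟩. If that arc enters x we are done.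
-- Otherwise it leaves x towards some y ≠ x, and y reaches a vertex z ∈ K by a path
-- (the trivial one if y ∈ K). If x were not on this path, prepending the arc (x,y)
-- would give a path between the distinct kernel vertices x and z; so x is on it, and
-- the arc of the path entering x lies in a class of S.

open import Defs
open import Data.Nat using (ℕ)
open import Data.Fin using (Fin; _≟_)
open import Data.Fin.Subset using (Subset; _∈_; Nonempty)
open import Data.Fin.Subset.Properties using (_∈?_)
import Data.List.Relation.Unary.All as All
import Data.List.Membership.Propositional as List
import Data.List.Membership.DecPropositional as DecMembership
open import Data.List.Relation.Unary.Any using (here; there)
open import Data.List.Relation.Unary.All.Properties using (¬Any⇒All¬)
import Data.List.Relation.Unary.AllPairs as AllPairs
open import Data.Product using (∃; _×_; _,_; proj₁)
open import Data.Sum using (inj₁; inj₂)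
open import Data.Empty using (⊥-elim)
open import Relation.Nullary using (yes; no)
open import Relation.Binary.PropositionalEquality using (_≢_; refl; sym; trans)

module _ {n : ℕ} {R : Fin n → Fin n → Set} where

  last∈walkVertices : ∀ {u v} (w : Walk R u v) → v List.∈ walkVertices w
  last∈walkVertices (stop u)   = here refl
  last∈walkVertices (step _ w) = there (last∈walkVertices w)

  ∈walkVertices⇒predecessor : ∀ {u v x} (w : Walk R u v) →
                              x List.∈ walkVertices w → x ≢ u → ∃ λ y → R y x
  ∈walkVertices⇒predecessor (stop u)   (here refl) x≢u = ⊥-elim (x≢u refl)
  ∈walkVertices⇒predecessor (step r w) (here refl) x≢u = ⊥-elim (x≢u refl)
  ∈walkVertices⇒predecessor {x = x} (step {v = v} r w) (there x∈w) x≢u with x ≟ v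
  ... | yes refl = _ , r
  ... | no  x≢v  = ∈walkVertices⇒predecessor w x∈w x≢v

  step-path : ∀ {x y z} → R x y → (p : Path R y z) →
              x List.∉ walkVertices (proj₁ p) → Path R x z
  step-path r (w , unique) x∉w = step r w , ¬Any⇒All¬ _ x∉w AllPairs.∷ unique

module _ {n : ℕ} {V : Fin n → Set} {R : Fin n → Fin n → Set} {K : Subset n}
         (kernel : KernelByPaths V R K) where
  open KernelByPaths kernel
  open DecMembership (_≟_ {n}) using () renaming (_∈?_ to _∈ₗ?_)

  reaches-kernel : ∀ {y} → V y → ∃ λ z → z ∈ K × Path R y z
  reaches-kernel {y} Vy with y ∈? K
  ... | yes y∈K = y , y∈K , stop y , All.[] AllPairs.∷ AllPairs.[]
  ... | no  y∉K = absorbing y Vy y∉K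

  kernel-outArc⇒inArc : ∀ {x y} → x ∈ K → R x y → x ≢ y → V y → ∃ λ u → R u x
  kernel-outArc⇒inArc {x} {y} x∈K x→y x≢y Vy with reaches-kernel Vy
  ... | z , z∈K , p with x ∈ₗ? walkVertices (proj₁ p)
  ...   | yes x∈p = ∈walkVertices⇒predecessor (proj₁ p) x∈p x≢y
  ...   | no  x∉p = ⊥-elim (independent x z x∈K z∈K x≢z (step-path x→y p x∉p))
    where
    x≢z : x ≢ z
    x≢z refl = x∉p (last∈walkVertices (proj₁ p))

loopless⇒arc-ends-distinct : ∀ {n} {D : Digraph n} → Loopless D →
                             ∀ {x y} → Digraph.Arc D x y → x ≢ y
loopless⇒arc-ends-distinct loopless {x} arc refl with trans (sym arc) (loopless x)
... | ()

module _ {m n k : ℕ} {H : Digraph m} {D : HColoredDigraph H n}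
         (𝓕 : HClassPartition D k) (S : Subset k) where

  SubArc⇒InNbhdMeetsS : ∀ {u x} → SubArc 𝓕 S u x → InNbhdMeetsS 𝓕 S x
  SubArc⇒InNbhdMeetsS {u} (arc , cls∈S) = _ , cls∈S , u , arc , refl

lemma10 : ∀ {m n k : ℕ} (H : Digraph m) (D : HColoredDigraph H n)
            (𝓕 : HClassPartition D k) (S : Subset k) → Nonempty S →
            (K : Subset n) → KernelByPaths (SubVertex 𝓕 S) (SubArc 𝓕 S) K →
            ∀ x → x ∈ K → InNbhdMeetsS 𝓕 S x
lemma10 H D 𝓕 S _ K kernel x x∈K with KernelByPaths.inV kernel x x∈K
... | _ , inj₂ y→x = SubArc⇒InNbhdMeetsS 𝓕 S y→x
... | _ , inj₁ x→y@(arc , _) =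
  let x≢y     = loopless⇒arc-ends-distinct (HColoredDigraph.loopless D) arc
      u , u→x = kernel-outArc⇒inArc kernel x∈K x→y x≢y (x , inj₂ x→y)
  in SubArc⇒InNbhdMeetsS 𝓕 S u→x
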